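{- Let $\mathcal{L}$ be a representably $\Sigma$-additive symmetric monoidal category. Then for every object $X$ and every $n\in\mathbb{N}$, the family of morphisms $(X\otimes\mathrm{in}_{i_1}\otimes\cdots\otimes\mathrm{in}_{i_n})_{(i_1,\dots,i_n)\in\mathbb{N}^n}$, from $X\otimes1^{\otimes n}$ to $X\otimes\mathcal{D}^{\otimes n}$, is jointly epic.
   Context: $\mathcal{L}$ symmetric monoidal with tensor $\otimes$, unit $1$, right unitor $\rho_X:X\otimes1\to X$ (associators kept implicit). A family of morphisms $(g_k:A_k\to B)$ is jointly epic if $f\circ g_k=f'\circ g_k$ for all $k$ implies $f=f'$. $\Sigma$-monoid: nonempty set with a partial operation $\Sigma$ on families indexed by at most countable sets (families in the domain are summable) such that every one-element family $x$ is summable with sum $x$ and, for every family $(x_a)_{a\in A}$ and partition $(A_i)_{i\in I}$ of $A$ ($I$ at most countable, parts possibly empty), $\sum_{a\in A}x_a\simeq\sum_{i\in I}\sum_{a\in A_i}x_a$ ($\simeq$: one side defined iff the other is, and equal). The empty sum is $0$. Representably $\Sigma$-additive: $\mathcal{L}$ has the countable product $\mathcal{D}=\mathbin{\&}_{i\in\mathbb{N}}1$ with projections $p_i$, and internal homs $(\mathcal{D}\multimap X,\mathrm{ev})$ for every $X$; put $\mathrm{in}_i=\langle\delta_{ji}\rangle_{j}\in\mathcal{L}(1,\mathcal{D})$ ($\delta_{ji}=\mathrm{id}_1$ if $j=i$, zero morphism otherwise) and $\Delta=\langle\mathrm{id}_1\rangle_{i\in\mathbb{N}}$. Conditions: (RS-epi)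 $(X\otimes\mathrm{in}_i)_i$ jointly epic for all $X$; (RS-mon) every $\mathcal{L}(X,Y)$ is a $\Sigma$-monoid whose $0$ is a zero morphism with $f\circ0=0$, $0\circ g=0$, $0\otimes g=0$, $f\otimes 0=0$; (RS-sum) $(f_i)_{i\in\mathbb{N}}$ in $\mathcal{L}(X,Y)$ is summable iff there is $h\in\mathcal{L}(X\otimes\mathcal{D},Y)$ with $h\circ(X\otimes\mathrm{in}_i)\circ\rho_X^{ -1}=f_i$ for all $i$, and then $\sum_i f_i=h\circ(X\otimes\Delta)\circ\rho_X^{ -1}$; (RS-witness) if $(h_a)_{a\in A}$ in $\mathcal{L}(X\otimes\mathcal{D},Y)$ is such that $(h_a\circ(X\otimes\mathrm{in}_j)\circ\rho_X^{ -1})_{(a,j)}$ is summable, then $(h_a)_a$ is summable. For $n=0$ the family consists of the single morphism $\mathrm{id}_X$. -}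

module Defs where

open import Level using (Level; _⊔_) renaming (suc to lsuc; zero to lzero)
open import Data.Nat using (ℕ; zero; suc)
open import Data.Fin using (Fin; inject₁; fromℕ)
open import Data.Product using (Σ; _×_; _,_; proj₁; proj₂; ∃)
open import Data.Empty using (⊥)
open import Function.Bundles using (_⇔_)
open import Function.Definitions using (Injective)
open import Relation.Binary.PropositionalEquality using (_≡_)

record SymMonCat (o ℓ : Level) : Set (lsuc (o ⊔ ℓ)) where
  infixr 9 _∘_
  infixr 10 _⊗₀_ _⊗₁_
  field
    Obj : Set o
    Hom : Obj → Obj → Set ℓ
    id  : ∀ {A} → Hom A A
    _∘_ : ∀ {A B C} → Hom B C → Hom A B → Hom A C
    identityˡ : ∀ {A B} {f : Hom A B} → id ∘ f ≡ f
    identityʳ : ∀ {A B} {f : Hom A B} → f ∘ id ≡ f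
    assoc : ∀ {A B C D} {f : Hom A B} {g : Hom B C} {h : Hom C D} →
            (h ∘ g) ∘ f ≡ h ∘ (g ∘ f)

    _⊗₀_ : Obj → Obj → Obj
    _⊗₁_ : ∀ {A B C D} → Hom A B → Hom C D → Hom (A ⊗₀ C) (B ⊗₀ D)
    ⊗-id : ∀ {A C} → id {A} ⊗₁ id {C} ≡ id
    ⊗-∘  : ∀ {A B C D E F} {f : Hom B C} {g : Hom A B} {h : Hom E F} {k : Hom D E} →
           (f ∘ g) ⊗₁ (h ∘ k) ≡ (f ⊗₁ h) ∘ (g ⊗₁ k)
    unit : Obj

    α⇒ : ∀ {A B C} → Hom ((A ⊗₀ B) ⊗₀ C) (A ⊗₀ (B ⊗₀ C))
    α⇐ : ∀ {A B C} → Hom (A ⊗₀ (B ⊗₀ C)) ((A ⊗₀ B) ⊗₀ C)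
    α-isoˡ : ∀ {A B C} → α⇐ {A} {B} {C} ∘ α⇒ ≡ id
    α-isoʳ : ∀ {A B C} → α⇒ {A} {B} {C} ∘ α⇐ ≡ id
    α-natural : ∀ {A B C A' B' C'} {f : Hom A A'} {g : Hom B B'} {h : Hom C C'} →
                α⇒ ∘ ((f ⊗₁ g) ⊗₁ h) ≡ (f ⊗₁ (g ⊗₁ h)) ∘ α⇒

    λ⇒ : ∀ {A} → Hom (unit ⊗₀ A) A
    λ⇐ : ∀ {A} → Hom A (unit ⊗₀ A)
    λ-isoˡ : ∀ {A} → λ⇐ {A} ∘ λ⇒ ≡ id
    λ-isoʳ : ∀ {A} → λ⇒ {A} ∘ λ⇐ ≡ id
    λ-natural : ∀ {A B} {f : Hom A B} → λ⇒ ∘ (id ⊗₁ f) ≡ f ∘ λ⇒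

    ρ⇒ : ∀ {A} → Hom (A ⊗₀ unit) A
    ρ⇐ : ∀ {A} → Hom A (A ⊗₀ unit)
    ρ-isoˡ : ∀ {A} → ρ⇐ {A} ∘ ρ⇒ ≡ id
    ρ-isoʳ : ∀ {A} → ρ⇒ {A} ∘ ρ⇐ ≡ id
    ρ-natural : ∀ {A B} {f : Hom A B} → ρ⇒ ∘ (f ⊗₁ id) ≡ f ∘ ρ⇒

    σ : ∀ {A B} → Hom (A ⊗₀ B) (B ⊗₀ A)
    σ-natural : ∀ {A B C D} {f : Hom A B} {g : Hom C D} →
                σ ∘ (f ⊗₁ g) ≡ (g ⊗₁ f) ∘ σ
    σ-involutive : ∀ {A B} → σ {B} {A} ∘ σ {A} {B} ≡ id

    pentagon : ∀ {A B C D} →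
      α⇒ {A} {B} {C ⊗₀ D} ∘ α⇒ {A ⊗₀ B} {C} {D}
        ≡ (id ⊗₁ α⇒) ∘ (α⇒ {A} {B ⊗₀ C} {D} ∘ (α⇒ ⊗₁ id))
    triangle : ∀ {A B} → (id {A} ⊗₁ λ⇒ {B}) ∘ α⇒ ≡ ρ⇒ ⊗₁ id
    hexagon : ∀ {A B C} →
      α⇒ {B} {C} {A} ∘ (σ {A} {B ⊗₀ C} ∘ α⇒ {A} {B} {C})
        ≡ (id ⊗₁ σ {A} {C}) ∘ (α⇒ {B} {A} {C} ∘ (σ {A} {B} ⊗₁ id))

AtMostCountable : Set → Set
AtMostCountable A = Σ (A → ℕ) (λ e → Injective _≡_ _≡_ e)

Fiber : {A I : Set} → (A → I) → I → Set
Fiber {A} π i = Σ A (λ a → π a ≡ i)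

-- The partial operation Σ is given as a functional relation  Sum x m
-- ("the family x is summable with sum m"); it is only defined on
-- families indexed by at most countable sets.
record SigmaMonoid {ℓ : Level} (M : Set ℓ) : Set (lsuc ℓ) where
  field
    Sum : {A : Set} → (A → M) → M → Set ℓ
    Sum-countable : ∀ {A} {x : A → M} {m} → Sum x m → AtMostCountable A
    Sum-functional : ∀ {A} {x : A → M} {m m'} → Sum x m → Sum x m' → m ≡ m'
    nonempty : M
    Sum-single : ∀ {A : Set} (a : A) → (∀ b → b ≡ a) → (x : A → M) → Sum x (x a)
    Sum-partition : ∀ {A I : Set} → AtMostCountable A → AtMostCountable I →
      (π : A → I) (x : A → M) (m : M) →
      Sum x m ⇔ Σ (I → M) (λ y →
        ((i : I) → Sum (λ (a : Fiber π i) → x (proj₁ a)) (y i)) × Sum y m)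
    -- the empty sum 0 (its existence is a consequence of the axioms above;
    -- it is recorded explicitly so that it can be named)
    𝟘 : M
    𝟘-sum : Sum (λ (a : ⊥) → nonempty) 𝟘

  Summable : {A : Set} → (A → M) → Set ℓ
  Summable x = ∃ (Sum x)

module _ {o ℓ : Level} (𝓛 : SymMonCat o ℓ) where
  open SymMonCat 𝓛

  JointlyEpic : {K : Set} {A : K → Obj} {B : Obj} → ((k : K) → Hom (A k) B) → Set (o ⊔ ℓ)
  JointlyEpic {K} {A} {B} g =
    ∀ {Z : Obj} (f f' : Hom B Z) → ((k : K) → f ∘ g k ≡ f' ∘ g k) → f ≡ f'

  record RSStructure : Set (o ⊔ lsuc ℓ) where
    field
      homΣ : (X Y : Obj) → SigmaMonoid (Hom X Y)

      𝒟 : Obj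
      p : ℕ → Hom 𝒟 unit
      ⟨_⟩ : ∀ {Y} → (ℕ → Hom Y unit) → Hom Y 𝒟
      p-β : ∀ {Y} (f : ℕ → Hom Y unit) (i : ℕ) → p i ∘ ⟨ f ⟩ ≡ f i
      ⟨⟩-unique : ∀ {Y} (f : ℕ → Hom Y unit) (h : Hom Y 𝒟) →
                  ((i : ℕ) → p i ∘ h ≡ f i) → h ≡ ⟨ f ⟩

      _⊸_ : Obj → Obj → Obj
      ev : ∀ {X} → Hom ((𝒟 ⊸ X) ⊗₀ 𝒟) X
      curry : ∀ {Z X} → Hom (Z ⊗₀ 𝒟) X → Hom Z (𝒟 ⊸ X)
      curry-β : ∀ {Z X} (f : Hom (Z ⊗₀ 𝒟) X) → ev ∘ (curry f ⊗₁ id) ≡ f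
      curry-unique : ∀ {Z X} (f : Hom (Z ⊗₀ 𝒟) X) (g : Hom Z (𝒟 ⊸ X)) →
                     ev ∘ (g ⊗₁ id) ≡ f → g ≡ curry f

    zeroMor : (X Y : Obj) → Hom X Y
    zeroMor X Y = SigmaMonoid.𝟘 (homΣ X Y)

    δ : ℕ → ℕ → Hom unit unit
    δ zero    zero    = id
    δ (suc j) (suc i) = δ j i
    δ zero    (suc i) = zeroMor unit unit
    δ (suc j) zero    = zeroMor unit unit

    in' : ℕ → Hom unit 𝒟
    in' i = ⟨ (λ j → δ j i) ⟩

    Δ : Hom unit 𝒟
    Δ = ⟨ (λ _ → id) ⟩

  record IsRSAdditive (S : RSStructure) : Set (o ⊔ lsuc ℓ) where
    open RSStructure S
    open module HΣ {X} {Y} = SigmaMonoid (homΣ X Y)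
      using (Sum; Summable; 𝟘)
    field
      RS-epi : ∀ (X : Obj) → JointlyEpic (λ (i : ℕ) → id {X} ⊗₁ in' i)

      RS-mon-∘ˡ : ∀ {X Y Z} (f : Hom Y Z) → f ∘ zeroMor X Y ≡ zeroMor X Z
      RS-mon-∘ʳ : ∀ {X Y Z} (g : Hom X Y) → zeroMor Y Z ∘ g ≡ zeroMor X Z
      RS-mon-⊗ˡ : ∀ {X Y Z W} (g : Hom Z W) →
                  zeroMor X Y ⊗₁ g ≡ zeroMor (X ⊗₀ Z) (Y ⊗₀ W)
      RS-mon-⊗ʳ : ∀ {X Y Z W} (f : Hom X Y) →
                  f ⊗₁ zeroMor Z W ≡ zeroMor (X ⊗₀ Z) (Y ⊗₀ W)

      -- (RS-sum), "only if" direction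
      RS-sum-witness : ∀ {X Y} (f : ℕ → Hom X Y) → Summable f →
        Σ (Hom (X ⊗₀ 𝒟) Y) (λ h → (i : ℕ) → h ∘ ((id ⊗₁ in' i) ∘ ρ⇐) ≡ f i)
      -- (RS-sum), "if" direction together with the value of the sum
      RS-sum-value : ∀ {X Y} (f : ℕ → Hom X Y) (h : Hom (X ⊗₀ 𝒟) Y) →
        ((i : ℕ) → h ∘ ((id ⊗₁ in' i) ∘ ρ⇐) ≡ f i) →
        Sum f (h ∘ ((id ⊗₁ Δ) ∘ ρ⇐))

      RS-witness : ∀ {A : Set} {X Y} (h : A → Hom (X ⊗₀ 𝒟) Y) →
        Summable (λ (aj : A × ℕ) → h (proj₁ aj) ∘ ((id ⊗₁ in' (proj₂ aj)) ∘ ρ⇐)) →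
        Summable h

  _⊗[_]^_ : Obj → Obj → ℕ → Obj
  X ⊗[ A ]^ zero  = X
  X ⊗[ A ]^ suc n = (X ⊗[ A ]^ n) ⊗₀ A

  inTensor : (S : RSStructure) (X : Obj) (n : ℕ) (i : Fin n → ℕ) →
    Hom (X ⊗[ unit ]^ n) (X ⊗[ RSStructure.𝒟 S ]^ n)
  inTensor S X zero    i = id
  inTensor S X (suc n) i = inTensor S X n (λ k → i (inject₁ k)) ⊗₁ RSStructure.in' S (i (fromℕ n))

-- The (n+1)-st family is the composite of the family
-- (id ⊗ in_j)_j, jointly epic by (RS-epi) at the object X ⊗ 𝒟^{⊗n}, with the
-- families (X ⊗ in_{i_1} ⊗ ⋯ ⊗ in_{i_n}) ⊗ id_1, jointly epic by induction
-- since tensoring with the unit is conjugation by the right unitor.  A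
-- composite of jointly epic families is jointly epic.
module Submission where

open import Defs
open import Level using (Level)
open import Data.Nat using (ℕ; zero; suc)
open import Data.Fin using (Fin; inject₁; fromℕ)
import Data.Fin as Fin
open import Data.Product using (Σ; ∃₂; _,_)
open import Data.Vec.Functional using (Vector; _∷_; head; tail; init; last)
open import Relation.Binary.PropositionalEquality

module _ {A : Set} where

  infixl 5 _∷ʳ_

  _∷ʳ_ : ∀ {n} → Vector A n → A → Vector A (suc n)
  _∷ʳ_ {zero}  xs x = λ _ → x
  _∷ʳ_ {suc n} xs x = head xs ∷ (tail xs ∷ʳ x)

  init-∷ʳ : ∀ {n} (xs : Vector A n) (x : A) → init (xs ∷ʳ x) ≗ xs
  init-∷ʳ {suc n} xs x Fin.zero    = refl
  init-∷ʳ {suc n} xs x (Fin.suc k) = init-∷ʳ (tail xs) x k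

  last-∷ʳ : ∀ {n} (xs : Vector A n) (x : A) → last (xs ∷ʳ x) ≡ x
  last-∷ʳ {zero}  xs x = refl
  last-∷ʳ {suc n} xs x = last-∷ʳ (tail xs) x

module JointlyEpicProperties {o ℓ : Level} (𝓛 : SymMonCat o ℓ) where
  open SymMonCat 𝓛
  open ≡-Reasoning

  JointlyEpic-∘ : ∀ {K : Set} {L : K → Set} {A : K → Obj} {C : (k : K) → L k → Obj} {B}
    {g : (k : K) → Hom (A k) B} {h : (k : K) (l : L k) → Hom (C k l) (A k)} →
    JointlyEpic 𝓛 g → (∀ k → JointlyEpic 𝓛 (h k)) →
    JointlyEpic 𝓛 (λ ((k , l) : Σ K L) → g k ∘ h k l)
  JointlyEpic-∘ {g = g} {h} g-epi h-epi f f' eq =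
    g-epi f f' λ k → h-epi k (f ∘ g k) (f' ∘ g k) λ l →
      trans assoc (trans (eq (k , l)) (sym assoc))

  JointlyEpic-factor : ∀ {K K' : Set} {A : K → Obj} {A' : K' → Obj} {B}
    {g : (k : K) → Hom (A k) B} {g' : (k' : K') → Hom (A' k') B} →
    JointlyEpic 𝓛 g →
    (∀ k → ∃₂ λ k' (u : Hom (A k) (A' k')) → g k ≡ g' k' ∘ u) →
    JointlyEpic 𝓛 g'
  JointlyEpic-factor {g = g} {g'} g-epi factor f f' eq = g-epi f f' λ k →
    let (k' , u , g≡g'u) = factor k in begin
      f ∘ g k           ≡⟨ cong (f ∘_) g≡g'u ⟩
      f ∘ (g' k' ∘ u)   ≡⟨ sym assoc ⟩
      (f ∘ g' k') ∘ u   ≡⟨ cong (_∘ u) (eq k') ⟩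
      (f' ∘ g' k') ∘ u  ≡⟨ assoc ⟩
      f' ∘ (g' k' ∘ u)  ≡⟨ cong (f' ∘_) (sym g≡g'u) ⟩
      f' ∘ g k          ∎

  ρ⇐-natural : ∀ {A B} (g : Hom A B) → ρ⇐ ∘ g ≡ (g ⊗₁ id) ∘ ρ⇐
  ρ⇐-natural g = begin
    ρ⇐ ∘ g                         ≡⟨ cong (ρ⇐ ∘_) (sym identityʳ) ⟩
    ρ⇐ ∘ (g ∘ id)                  ≡⟨ cong (λ t → ρ⇐ ∘ (g ∘ t)) (sym ρ-isoʳ) ⟩
    ρ⇐ ∘ (g ∘ (ρ⇒ ∘ ρ⇐))           ≡⟨ cong (ρ⇐ ∘_) (sym assoc) ⟩
    ρ⇐ ∘ ((g ∘ ρ⇒) ∘ ρ⇐)           ≡⟨ cong (λ t → ρ⇐ ∘ (t ∘ ρ⇐)) (sym ρ-natural) ⟩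
    ρ⇐ ∘ ((ρ⇒ ∘ (g ⊗₁ id)) ∘ ρ⇐)   ≡⟨ sym assoc ⟩
    (ρ⇐ ∘ (ρ⇒ ∘ (g ⊗₁ id))) ∘ ρ⇐   ≡⟨ cong (_∘ ρ⇐) (sym assoc) ⟩
    ((ρ⇐ ∘ ρ⇒) ∘ (g ⊗₁ id)) ∘ ρ⇐   ≡⟨ cong (λ t → (t ∘ (g ⊗₁ id)) ∘ ρ⇐) ρ-isoˡ ⟩
    (id ∘ (g ⊗₁ id)) ∘ ρ⇐          ≡⟨ cong (_∘ ρ⇐) identityˡ ⟩
    (g ⊗₁ id) ∘ ρ⇐                 ∎

  ρ⇐-epic : ∀ {A Z} {f f' : Hom (A ⊗₀ unit) Z} → f ∘ ρ⇐ ≡ f' ∘ ρ⇐ → f ≡ f'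
  ρ⇐-epic {f = f} {f'} eq = begin
    f              ≡⟨ sym identityʳ ⟩
    f ∘ id         ≡⟨ cong (f ∘_) (sym ρ-isoˡ) ⟩
    f ∘ (ρ⇐ ∘ ρ⇒)  ≡⟨ sym assoc ⟩
    (f ∘ ρ⇐) ∘ ρ⇒  ≡⟨ cong (_∘ ρ⇒) eq ⟩
    (f' ∘ ρ⇐) ∘ ρ⇒ ≡⟨ assoc ⟩
    f' ∘ (ρ⇐ ∘ ρ⇒) ≡⟨ cong (f' ∘_) ρ-isoˡ ⟩
    f' ∘ id        ≡⟨ identityʳ ⟩
    f'             ∎

  JointlyEpic-⊗unit : ∀ {K : Set} {A : K → Obj} {B} {g : (k : K) → Hom (A k) B} →
    JointlyEpic 𝓛 g → JointlyEpic 𝓛 (λ k → g k ⊗₁ id {unit})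
  JointlyEpic-⊗unit {g = g} g-epi f f' eq = ρ⇐-epic (g-epi (f ∘ ρ⇐) (f' ∘ ρ⇐) λ k →
    begin
      (f ∘ ρ⇐) ∘ g k              ≡⟨ assoc ⟩
      f ∘ (ρ⇐ ∘ g k)              ≡⟨ cong (f ∘_) (ρ⇐-natural (g k)) ⟩
      f ∘ ((g k ⊗₁ id) ∘ ρ⇐)      ≡⟨ sym assoc ⟩
      (f ∘ (g k ⊗₁ id)) ∘ ρ⇐      ≡⟨ cong (_∘ ρ⇐) (eq k) ⟩
      (f' ∘ (g k ⊗₁ id)) ∘ ρ⇐     ≡⟨ assoc ⟩
      f' ∘ ((g k ⊗₁ id) ∘ ρ⇐)     ≡⟨ cong (f' ∘_) (sym (ρ⇐-natural (g k))) ⟩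
      f' ∘ (ρ⇐ ∘ g k)             ≡⟨ sym assoc ⟩
      (f' ∘ ρ⇐) ∘ g k             ∎)

module InTensor {o ℓ : Level} (𝓛 : SymMonCat o ℓ) (S : RSStructure 𝓛) (X : SymMonCat.Obj 𝓛) where
  open SymMonCat 𝓛
  open RSStructure S
  open ≡-Reasoning

  inTensor-cong : ∀ n {i i' : Fin n → ℕ} → i ≗ i' → inTensor 𝓛 S X n i ≡ inTensor 𝓛 S X n i'
  inTensor-cong zero    eq = refl
  inTensor-cong (suc n) eq =
    cong₂ _⊗₁_ (inTensor-cong n (λ k → eq (inject₁ k))) (cong in' (eq (fromℕ n)))

  inTensor-∷ʳ : ∀ n (i : Fin n → ℕ) (j : ℕ) →
    (id ⊗₁ in' j) ∘ (inTensor 𝓛 S X n i ⊗₁ id) ≡ inTensor 𝓛 S X (suc n) (i ∷ʳ j)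
  inTensor-∷ʳ n i j = begin
    (id ⊗₁ in' j) ∘ (inTensor 𝓛 S X n i ⊗₁ id)   ≡⟨ sym ⊗-∘ ⟩
    (id ∘ inTensor 𝓛 S X n i) ⊗₁ (in' j ∘ id)    ≡⟨ cong₂ _⊗₁_ identityˡ identityʳ ⟩
    inTensor 𝓛 S X n i ⊗₁ in' j                  ≡⟨ cong₂ _⊗₁_ (inTensor-cong n (λ k → sym (init-∷ʳ i j k)))
                                                              (cong in' (sym (last-∷ʳ i j))) ⟩
    inTensor 𝓛 S X (suc n) (i ∷ʳ j)              ∎

mainTheorem17 : {o ℓ : Level} (𝓛 : SymMonCat o ℓ) (S : RSStructure 𝓛) →
    IsRSAdditive 𝓛 S →
    (X : SymMonCat.Obj 𝓛) (n : ℕ) →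
    JointlyEpic 𝓛 (λ (i : Fin n → ℕ) → inTensor 𝓛 S X n i)
mainTheorem17 𝓛 _ _ _ zero f f' eq =
  trans (sym identityʳ) (trans (eq (λ ())) identityʳ)
  where open SymMonCat 𝓛
mainTheorem17 𝓛 S rs X (suc n) =
  JointlyEpic-factor
    (JointlyEpic-∘ (RS-epi (_⊗[_]^_ 𝓛 X 𝒟 n)) λ _ → JointlyEpic-⊗unit (mainTheorem17 𝓛 S rs X n))
    λ (j , i) → i ∷ʳ j , id , trans (inTensor-∷ʳ n i j) (sym identityʳ)
  where
  open SymMonCat 𝓛
  open RSStructure S
  open IsRSAdditive rs
  open JointlyEpicProperties 𝓛
  open InTensor 𝓛 S X
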